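{- (i) If $G=(V,E)$ is a complete multi-partite graph with $|V|=n$ and $\omega:V\to[n]$ is any bijection, then $\mathcal{W}(G_\omega)=\emptyset$; in particular $G\in\mathcal{G}$. (ii) If $G$ is disconnected, then $G\in\mathcal{G}$ if and only if each component of $G$ belongs to $\mathcal{G}$. (iii) If $G\in\mathcal{G}$, then the subgraph of $G$ induced by any subset $S\subseteq V(G)$ belongs to $\mathcal{G}$.
   Context: For a simple graph $H$ whose vertex set is a set of positive integers, $\mathcal{W}(H)$ is the set of $3$-element vertex subsets $\{a,b,c\}$ with $a<b<c$ such that $ac$ is an edge and $ab$, $bc$ are non-edges. For a simple graph $G$ on $n$ vertices and a bijection $\omega:V(G)\to[n]$, $G_\omega$ is the graph obtained by relabeling each vertex $v$ as $\omega(v)$. $\mathcal{G}$ denotes the class of simple graphs $G$ (on any number $n$ of vertices) for which there exists a bijection $\omega:V(G)\to[n]$ with $\mathcal{W}(G_\omega)=\emptyset$. -}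

module Defs where

open import Data.Nat using (ℕ)
open import Data.Bool using (Bool; true; false)
open import Data.Fin using (Fin; _<_)
open import Data.Fin.Permutation using (Permutation′; _⟨$⟩ˡ_)
open import Data.Product using (Σ; ∃; _×_; _,_)
open import Relation.Binary.PropositionalEquality using (_≡_; _≢_)
open import Relation.Nullary using (¬_)
open import Function.Bundles using (_⇔_)
open import Function.Definitions using (Injective)

record Graph (n : ℕ) : Set where
  field
    adj        : Fin n → Fin n → Bool
    adj-sym    : ∀ u v → adj u v ≡ adj v u
    adj-irrefl : ∀ v → adj v v ≡ false
open Graph public

InW : ∀ {n} → Graph n → Fin n → Fin n → Fin n → Set
InW H a b c = (a < b) × (b < c) × (adj H a c ≡ true) × (adj H a b ≡ false) × (adj H b c ≡ false)

W-empty : ∀ {n} → Graph n → Set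
W-empty H = ∀ a b c → ¬ InW H a b c

-- G_ω : vertex v of G becomes ω(v); so vertex i of G_ω is ω⁻¹(i).
relabel : ∀ {n} → Graph n → Permutation′ n → Graph n
relabel G ω = record
  { adj        = λ i j → adj G (ω ⟨$⟩ˡ i) (ω ⟨$⟩ˡ j)
  ; adj-sym    = λ i j → adj-sym G (ω ⟨$⟩ˡ i) (ω ⟨$⟩ˡ j)
  ; adj-irrefl = λ i → adj-irrefl G (ω ⟨$⟩ˡ i)
  }

InClassG : ∀ {n} → Graph n → Set
InClassG {n} G = Σ (Permutation′ n) λ ω → W-empty (relabel G ω)

CompleteMultipartite : ∀ {n} → Graph n → Set
CompleteMultipartite {n} G =
  Σ ℕ λ k → Σ (Fin n → Fin k) λ part →
    ∀ u v → (adj G u v ≡ true) ⇔ (part u ≢ part v)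

-- pullback of G along f : Fin m → Fin n (the induced subgraph on the image
-- of f when f is injective)
pullback : ∀ {m n} → Graph n → (Fin m → Fin n) → Graph m
pullback G f = record
  { adj        = λ i j → adj G (f i) (f j)
  ; adj-sym    = λ i j → adj-sym G (f i) (f j)
  ; adj-irrefl = λ i → adj-irrefl G (f i)
  }

Enumerates : ∀ {m n} → (Fin n → Set) → (Fin m → Fin n) → Set
Enumerates S f = Injective _≡_ _≡_ f × (∀ v → S v ⇔ (∃ λ i → f i ≡ v))

InducedInClassG : ∀ {n} → Graph n → (Fin n → Set) → Set
InducedInClassG {n} G S =
  ∀ m (f : Fin m → Fin n) → Enumerates S f → InClassG (pullback G f)

data Reach {n} (G : Graph n) (u : Fin n) : Fin n → Set where
  here : Reach G u u
  step : ∀ {v w} → Reach G u v → adj G v w ≡ true → Reach G u w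

Disconnected : ∀ {n} → Graph n → Set
Disconnected G = ∃ λ u → ∃ λ v → ¬ Reach G u v

AllComponentsInClassG : ∀ {n} → Graph n → Set
AllComponentsInClassG {n} G = ∀ (v : Fin n) → InducedInClassG G (Reach G v)

-- A vertex order has a W-triple exactly when some x ⊏ y ⊏ z has xz an edge and y adjacent
-- to neither x nor z; a good order is then obtained by sorting along an injective key into
-- a strict total order that avoids this configuration.
-- (i) In a complete multipartite graph the configuration cannot occur for any order, since
-- non-adjacency means lying in the same part and that relation is transitive.
-- (iii) Ordering a vertex subset by the positions of its vertices in a good order of G gives
-- a good order of the induced subgraph; the "only if" half of (ii) is a special case.
-- (ii) Conversely, sort by (least vertex of the component, position in a good order of the
-- component) lexicographically. An edge xz keeps x and z in one component, components occupy
-- intervals, so y lies in it as well and the triple would be a W-triple of that component.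
-- Enumerating components needs reachability to be decidable: reachability by walks of length
-- at most k saturates for some k ≤ n, as each unsaturated round adds a new vertex.
module Submission where

open import Defs
open import Data.Bool using (true; false)
import Data.Bool.Properties as Bool
open import Data.Empty using (⊥; ⊥-elim)
open import Data.Fin as Fin using (Fin; zero; suc; toℕ; punchIn)
import Data.Fin.Properties as Fin
open import Data.Fin.Permutation
  using (Permutation′; _⟨$⟩ʳ_; _⟨$⟩ˡ_; id; flip; insert; inverseˡ)
open import Data.List using (List; _∷_; filter; allFin; lookup)
open import Data.List.Membership.Propositional.Properties
  using (∈-filter⁺; ∈-filter⁻; ∈-allFin; ∈-lookup)
import Data.List.Relation.Unary.All as All
open import Data.List.Relation.Unary.Any using (index)
open import Data.List.Relation.Unary.Any.Properties using (lookup-index)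
open import Data.List.Relation.Unary.Unique.Propositional using (Unique; _∷_)
open import Data.List.Relation.Unary.Unique.Propositional.Properties using (allFin⁺; filter⁺)
open import Data.Nat as ℕ using (ℕ; zero; suc; z≤n; s≤s; _≤′_; ≤′-refl; ≤′-step)
import Data.Nat.Properties as ℕ
open import Data.Product using (∃; ∃₂; _×_; _,_; proj₁; proj₂)
open import Data.Product.Relation.Binary.Lex.Strict using (×-strictTotalOrder)
open import Data.Sum using (_⊎_; inj₁; inj₂)
open import Function using (_∘_; _on_; _⇔_; mk⇔; Equivalence)
open import Function.Bundles using (Injection)
open import Function.Definitions using (Injective)
open import Function.Properties.Inverse using (↔⇒↣)
open import Level using (0ℓ)
open import Relation.Binary using (Rel; StrictTotalOrder; tri<; tri≈; tri>)
open import Relation.Binary.PropositionalEquality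
  using (_≡_; _≢_; refl; sym; trans; cong; subst; subst₂)
open import Relation.Nullary using (¬_; yes; no; contradiction)
open import Relation.Nullary.Decidable
  using (_×-dec_; _⊎-dec_; _→-dec_; ¬?; map′; decidable-stable)
open import Relation.Unary using (Pred; Decidable)

private variable
  m n : ℕ

module _ {a ℓ₁ ℓ₂} (O : StrictTotalOrder a ℓ₁ ℓ₂) where
  open StrictTotalOrder O renaming (Carrier to A; trans to <-trans)

  argmin : (g : Fin (suc m) → A) → Injective _≡_ _≈_ g →
           ∃ λ i → ∀ j → j ≢ i → g i < g j
  argmin {zero}  g _     = zero , λ { zero j≢0 → contradiction refl j≢0 }
  argmin {suc m} g g-inj with argmin (g ∘ suc) (Fin.suc-injective ∘ g-inj)
  ... | i , min with compare (g zero) (g (suc i))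
  ... | tri< g₀<gᵢ _ _ = zero , λ { zero j≢0 → contradiction refl j≢0 ; (suc j) _ → below j }
    where
    below : ∀ j → g zero < g (suc j)
    below j with j Fin.≟ i
    ... | yes refl = g₀<gᵢ
    ... | no j≢i   = <-trans g₀<gᵢ (min j j≢i)
  ... | tri≈ _ g₀≈gᵢ _ = contradiction (g-inj g₀≈gᵢ) λ ()
  ... | tri> _ _ gᵢ<g₀ = suc i , λ { zero _ → gᵢ<g₀ ; (suc j) j≢i → min j (j≢i ∘ cong suc) }

  sortingPermutation : (g : Fin m → A) → Injective _≡_ _≈_ g →
                       ∃ λ (σ : Permutation′ m) → ∀ {i j} → i Fin.< j → g (σ ⟨$⟩ˡ i) < g (σ ⟨$⟩ˡ j)
  sortingPermutation {zero}  g _     = id , λ { {()} }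
  sortingPermutation {suc m} g g-inj with argmin g g-inj
  ... | i , min with sortingPermutation (g ∘ punchIn i) (Fin.punchIn-injective i _ _ ∘ g-inj)
  ... | σ , sorted = τ , increasing
    where
    -- Definitionally, τ ⟨$⟩ˡ zero = i and τ ⟨$⟩ˡ suc k = punchIn i (σ ⟨$⟩ˡ k).
    τ : Permutation′ (suc m)
    τ = flip (insert zero i (flip σ))

    increasing : ∀ {j k} → j Fin.< k → g (τ ⟨$⟩ˡ j) < g (τ ⟨$⟩ˡ k)
    increasing {zero}  {suc k} _         = min _ (Fin.punchInᵢ≢i i (σ ⟨$⟩ˡ k))
    increasing {suc j} {suc k} (s≤s j<k) = sorted j<k

CoP₃ : Graph n → Fin n → Fin n → Fin n → Set
CoP₃ G x y z = (adj G x z ≡ true) × (adj G x y ≡ false) × (adj G y z ≡ false)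

W-emptyWrt : ∀ {ℓ} → Rel (Fin n) ℓ → Graph n → Set ℓ
W-emptyWrt _⊏_ G = ∀ {x y z} → x ⊏ y → y ⊏ z → ¬ CoP₃ G x y z

CoP₃-pullback : ∀ {G : Graph n} (f : Fin m → Fin n) {i j k x y z} →
                f i ≡ x → f j ≡ y → f k ≡ z → CoP₃ G x y z → CoP₃ (pullback G f) i j k
CoP₃-pullback f refl refl refl cop = cop

W-emptyWrt-pullback : ∀ {ℓ} {_⊏_ : Rel (Fin n) ℓ} {G : Graph n} (f : Fin m → Fin n) →
                      W-emptyWrt _⊏_ G → W-emptyWrt (_⊏_ on f) (pullback G f)
W-emptyWrt-pullback f noW {i} {j} {k} = noW {f i} {f j} {f k}

W-empty⇒W-emptyWrt : ∀ {G : Graph n} (ω : Permutation′ n) →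
                     W-empty (relabel G ω) → W-emptyWrt (Fin._<_ on (ω ⟨$⟩ʳ_)) G
W-empty⇒W-emptyWrt {G = G} ω noW {x} {y} {z} x⊏y y⊏z cop = noW _ _ _
  (x⊏y , y⊏z , CoP₃-pullback {G = G} (ω ⟨$⟩ˡ_) (inverseˡ ω {x}) (inverseˡ ω {y}) (inverseˡ ω {z}) cop)

W-emptyWrt⇒InClassG : ∀ {a ℓ₁ ℓ₂} (O : StrictTotalOrder a ℓ₁ ℓ₂) {G : Graph n}
                      (key : Fin n → StrictTotalOrder.Carrier O) →
                      Injective _≡_ (StrictTotalOrder._≈_ O) key →
                      W-emptyWrt (StrictTotalOrder._<_ O on key) G → InClassG G
W-emptyWrt⇒InClassG O key key-inj noW with sortingPermutation O key key-inj
... | σ , sorted = σ , λ _ _ _ (i<j , j<k , cop) → noW (sorted i<j) (sorted j<k) cop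

completeMultipartite⇒¬CoP₃ : ∀ {G : Graph n} → CompleteMultipartite G → ∀ {x y z} → ¬ CoP₃ G x y z
completeMultipartite⇒¬CoP₃ {G = G} (_ , part , adj⇔) {x} (xz , xy , yz) =
  Equivalence.to (adj⇔ x _) xz (trans (samePart xy) (samePart yz))
  where
  samePart : ∀ {u v} → adj G u v ≡ false → part u ≡ part v
  samePart {u} {v} uv = decidable-stable (part u Fin.≟ part v) λ parts≢ →
    contradiction (trans (sym (Equivalence.from (adj⇔ u v) parts≢)) uv) λ ()

completeMultipartite⇒W-empty : (G : Graph n) → CompleteMultipartite G →
                               (ω : Permutation′ n) → W-empty (relabel G ω)
completeMultipartite⇒W-empty G cm ω _ _ _ (_ , _ , cop) = completeMultipartite⇒¬CoP₃ {G = G} cm cop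

permutation-injective : (π : Permutation′ n) → Injective _≡_ _≡_ (π ⟨$⟩ʳ_)
permutation-injective π = Injection.injective (↔⇒↣ π)

InClassG-pullback : ∀ {G : Graph n} → InClassG G →
                    (f : Fin m → Fin n) → Injective _≡_ _≡_ f → InClassG (pullback G f)
InClassG-pullback {G = G} (ω , noW) f f-inj =
  W-emptyWrt⇒InClassG (Fin.<-strictTotalOrder _) {G = pullback G f} ((ω ⟨$⟩ʳ_) ∘ f) (f-inj ∘ permutation-injective ω)
    (W-emptyWrt-pullback {G = G} f (W-empty⇒W-emptyWrt {G = G} ω noW))

InClassG⇒InducedInClassG : (G : Graph n) → InClassG G → ∀ S → InducedInClassG G S
InClassG⇒InducedInClassG G inG S m f (f-inj , _) = InClassG-pullback {G = G} inG f f-inj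

module _ (G : Graph n) where

  Reach-trans : ∀ {u v w} → Reach G u v → Reach G v w → Reach G u w
  Reach-trans p here       = p
  Reach-trans p (step q e) = step (Reach-trans p q) e

  Reach-sym : ∀ {u v} → Reach G u v → Reach G v u
  Reach-sym here                = here
  Reach-sym (step {v} {w} p vw) = Reach-trans (step here (trans (adj-sym G w v) vw)) (Reach-sym p)

  ReachWithin : ℕ → Fin n → Fin n → Set
  ReachWithin zero    u w = u ≡ w
  ReachWithin (suc k) u w = ReachWithin k u w ⊎ ∃ λ v → ReachWithin k u v × adj G v w ≡ true

  reachWithin? : ∀ k u → Decidable (ReachWithin k u)
  reachWithin? zero    u w = u Fin.≟ w
  reachWithin? (suc k) u w =
    reachWithin? k u w ⊎-dec Fin.any? λ v → reachWithin? k u v ×-dec adj G v w Bool.≟ true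

  ReachWithin⇒Reach : ∀ k {u w} → ReachWithin k u w → Reach G u w
  ReachWithin⇒Reach zero    refl                = here
  ReachWithin⇒Reach (suc k) (inj₁ r)            = ReachWithin⇒Reach k r
  ReachWithin⇒Reach (suc k) (inj₂ (_ , r , vw)) = step (ReachWithin⇒Reach k r) vw

  ReachWithin-mono : ∀ {k l u w} → k ≤′ l → ReachWithin k u w → ReachWithin l u w
  ReachWithin-mono ≤′-refl        r = r
  ReachWithin-mono (≤′-step k≤′l) r = inj₁ (ReachWithin-mono k≤′l r)

  Saturated : ℕ → Fin n → Set
  Saturated k u = ∀ w → ReachWithin (suc k) u w → ReachWithin k u w

  Saturated⇒complete : ∀ {k u w} → Saturated k u → Reach G u w → ReachWithin k u w
  Saturated⇒complete sat here       = ReachWithin-mono (ℕ.≤⇒≤′ z≤n) refl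
  Saturated⇒complete sat (step p e) = sat _ (inj₂ (_ , Saturated⇒complete sat p , e))

  ¬Saturated⇒new : ∀ {k u} → ¬ Saturated k u → ∃ λ w → ReachWithin (suc k) u w × ¬ ReachWithin k u w
  ¬Saturated⇒new {k} {u} ¬sat
    with Fin.any? (λ w → reachWithin? (suc k) u w ×-dec ¬? (reachWithin? k u w))
  ... | yes new = new
  ... | no ¬new = contradiction
    (λ w r → decidable-stable (reachWithin? k u w) (λ ¬r → ¬new (w , r , ¬r))) ¬sat

  saturates : ∀ u → ∃ λ k → Saturated k u
  saturates u with Fin.any? {n = suc n}
    (λ k → Fin.all? λ w → reachWithin? (suc (toℕ k)) u w →-dec reachWithin? (toℕ k) u w)
  ... | yes (k , sat) = toℕ k , sat
  ... | no ¬sat = ⊥-elim repeated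
    where
    new : (k : Fin (suc n)) → ∃ λ w → ReachWithin (suc (toℕ k)) u w × ¬ ReachWithin (toℕ k) u w
    new k = ¬Saturated⇒new (λ sat → ¬sat (k , sat))

    repeated : ⊥
    repeated with Fin.pigeonhole (ℕ.n<1+n n) (proj₁ ∘ new)
    ... | i , j , i<j , wᵢ≡wⱼ with new i | new j
    ... | _ , rᵢ , _ | _ , _ , ¬rⱼ =
      ¬rⱼ (subst (ReachWithin (toℕ j) u) wᵢ≡wⱼ (ReachWithin-mono (ℕ.≤⇒≤′ i<j) rᵢ))

  -- Nothing computes with this search, and letting the type checker unfold it makes checking
  -- the component order below extremely slow.
  opaque
    Reach? : ∀ u → Decidable (Reach G u)
    Reach? u w with saturates u
    ... | k , sat = map′ (ReachWithin⇒Reach k) (Saturated⇒complete sat) (reachWithin? k u w)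

least : ∀ {p} {P : Pred (Fin n) p} → Decidable P → ∃ P → ∃ λ i → P i × ∀ {j} → P j → i Fin.≤ j
least {n = suc n} P? ∃P with P? zero
... | yes P₀ = zero , P₀ , λ _ → z≤n
least {n = suc n} P? (zero  , P₀) | no ¬P₀ = contradiction P₀ ¬P₀
least {n = suc n} P? (suc i , Pᵢ) | no ¬P₀ with least (P? ∘ suc) (i , Pᵢ)
... | j , Pⱼ , min = suc j , Pⱼ , λ { {zero} P₀ → contradiction P₀ ¬P₀ ; {suc k} Pₖ → s≤s (min Pₖ) }

lookup-injective : ∀ {a} {A : Set a} {xs : List A} → Unique xs → Injective _≡_ _≡_ (lookup xs)
lookup-injective (_    ∷ _) {zero}  {zero}  _   = refl
lookup-injective (x∉xs ∷ _) {zero}  {suc j} x≡y = contradiction x≡y (All.lookup x∉xs (∈-lookup j))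
lookup-injective (x∉xs ∷ _) {suc i} {zero}  y≡x = contradiction (sym y≡x) (All.lookup x∉xs (∈-lookup i))
lookup-injective {xs = _ ∷ _} (_ ∷ xs!) {suc i} {suc j} x≡y = cong suc (lookup-injective xs! x≡y)

enumerate : ∀ {P : Pred (Fin n) 0ℓ} → Decidable P → ∃₂ λ m (f : Fin m → Fin n) → Enumerates P f
enumerate {n} P? = _ , lookup xs , lookup-injective (filter⁺ P? (allFin⁺ n)) , λ v →
  mk⇔ (λ Pv → let v∈xs = ∈-filter⁺ P? (∈-allFin v) Pv in index v∈xs , sym (lookup-index v∈xs))
      (λ { (i , refl) → proj₂ (∈-filter⁻ P? {xs = allFin n} (∈-lookup i)) })
  where
  xs : List (Fin n)
  xs = filter P? (allFin n)

module ComponentOrder (G : Graph n) (components : AllComponentsInClassG G) where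

  size : Fin n → ℕ
  size r = proj₁ (enumerate (Reach? G r))

  member : (r : Fin n) → Fin (size r) → Fin n
  member r = proj₁ (proj₂ (enumerate (Reach? G r)))

  member-enumerates : ∀ r → Enumerates (Reach G r) (member r)
  member-enumerates r = proj₂ (proj₂ (enumerate (Reach? G r)))

  order : ∀ r → Permutation′ (size r)
  order r = proj₁ (components r _ _ (member-enumerates r))

  order-W-empty : ∀ r → W-emptyWrt (Fin._<_ on (order r ⟨$⟩ʳ_)) (pullback G (member r))
  order-W-empty r = W-empty⇒W-emptyWrt {G = pullback G (member r)} (order r) (proj₂ (components r _ _ (member-enumerates r)))

  rank : ∀ r → Fin (size r) → ℕ
  rank r i = toℕ (order r ⟨$⟩ʳ i)

  leader : Fin n → Fin n
  leader x = proj₁ (least (Reach? G x) (x , here))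

  leader-reaches : ∀ x → Reach G (leader x) x
  leader-reaches x = Reach-sym G (proj₁ (proj₂ (least (Reach? G x) (x , here))))

  leader-minimal : ∀ {x y} → Reach G x y → leader x Fin.≤ y
  leader-minimal {x} = proj₂ (proj₂ (least (Reach? G x) (x , here)))

  leader-cong : ∀ {x y} → Reach G x y → leader x ≡ leader y
  leader-cong {x} {y} x↝y = Fin.≤-antisym
    (leader-minimal (Reach-trans G x↝y (Reach-sym G (leader-reaches y))))
    (leader-minimal (Reach-trans G (Reach-sym G x↝y) (Reach-sym G (leader-reaches x))))

  position : ∀ x → Fin (size (leader x))
  position x = proj₁ (Equivalence.to (proj₂ (member-enumerates (leader x)) x) (leader-reaches x))

  member-position : ∀ x → member (leader x) (position x) ≡ x
  member-position x = proj₂ (Equivalence.to (proj₂ (member-enumerates (leader x)) x) (leader-reaches x))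

  Lex : StrictTotalOrder 0ℓ 0ℓ 0ℓ
  Lex = ×-strictTotalOrder (Fin.<-strictTotalOrder n) ℕ.<-strictTotalOrder

  open StrictTotalOrder Lex using () renaming (_<_ to _<ₗₑₓ_; _≈_ to _≈ₗₑₓ_)

  key : Fin n → Fin n × ℕ
  key x = leader x , rank (leader x) (position x)

  Located : Fin n → Fin n → Set
  Located r x = ∃ λ i → member r i ≡ x × proj₂ (key x) ≡ rank r i

  -- Abstracting the leader to a variable r is what lets positions of different vertices,
  -- a priori in the types Fin (size (leader x)), be compared inside a single component.
  located : ∀ {x r} → leader x ≡ r → Located r x
  located {x} refl = position x , member-position x , refl

  key-injective : Injective _≡_ _≈ₗₑₓ_ key
  key-injective {x} {y} (same-leader , same-rank) =
    same-position (located {x} refl) (located (sym same-leader))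
    where
    same-position : Located (leader x) x → Located (leader x) y → x ≡ y
    same-position (i , xᵢ , rᵢ) (j , yⱼ , rⱼ) =
      trans (sym xᵢ) (trans (cong (member (leader x)) i≡j) yⱼ)
      where
      i≡j : i ≡ j
      i≡j = permutation-injective (order (leader x))
              (Fin.toℕ-injective (trans (sym rᵢ) (trans same-rank rⱼ)))

  leader-≤ : ∀ {x y} → key x <ₗₑₓ key y → leader x Fin.≤ leader y
  leader-≤ (inj₁ lx<ly)       = ℕ.<⇒≤ lx<ly
  leader-≤ (inj₂ (lx≡ly , _)) = Fin.≤-reflexive lx≡ly

  rank-< : ∀ {x y} → leader x ≡ leader y → key x <ₗₑₓ key y → proj₂ (key x) ℕ.< proj₂ (key y)
  rank-< lx≡ly (inj₁ lx<ly)       = contradiction lx≡ly (Fin.<⇒≢ lx<ly)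
  rank-< _     (inj₂ (_ , rx<ry)) = rx<ry

  key-W-empty : W-emptyWrt (_<ₗₑₓ_ on key) G
  key-W-empty {x} {y} {z} x⊏y y⊏z cop@(xz , _) =
    within-component (located {x} refl) (located ly≡lx) (located (sym lx≡lz))
    where
    lx≡lz : leader x ≡ leader z
    lx≡lz = leader-cong (step here xz)

    ly≡lx : leader y ≡ leader x
    ly≡lx = Fin.≤-antisym (Fin.≤-trans (leader-≤ y⊏z) (Fin.≤-reflexive (sym lx≡lz))) (leader-≤ x⊏y)

    within-component : Located (leader x) x → Located (leader x) y → Located (leader x) z → ⊥
    within-component (i , xᵢ , rᵢ) (j , yⱼ , rⱼ) (k , zₖ , rₖ) = order-W-empty (leader x)
      (subst₂ ℕ._<_ rᵢ rⱼ (rank-< (sym ly≡lx) x⊏y))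
      (subst₂ ℕ._<_ rⱼ rₖ (rank-< (trans ly≡lx lx≡lz) y⊏z))
      (CoP₃-pullback {G = G} (member (leader x)) xᵢ yⱼ zₖ cop)

AllComponentsInClassG⇒InClassG : (G : Graph n) → AllComponentsInClassG G → InClassG G
AllComponentsInClassG⇒InClassG G components =
  W-emptyWrt⇒InClassG Lex {G = G} key key-injective key-W-empty
  where open ComponentOrder G components

proposition5p2 : (∀ (n : ℕ) (G : Graph n) → CompleteMultipartite G →
    ((ω : Permutation′ n) → W-empty (relabel G ω)) × InClassG G)
    × (∀ (n : ℕ) (G : Graph n) → Disconnected G →
    (InClassG G ⇔ AllComponentsInClassG G))
    × (∀ (n : ℕ) (G : Graph n) → InClassG G →
    ∀ (S : Fin n → Set) → InducedInClassG G S)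
proposition5p2 =
  (λ n G cm → completeMultipartite⇒W-empty G cm , id , completeMultipartite⇒W-empty G cm id)
  , (λ n G _ → mk⇔ (λ inG v → InClassG⇒InducedInClassG G inG (Reach G v))
                   (AllComponentsInClassG⇒InClassG G))
  , (λ n → InClassG⇒InducedInClassG)
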